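{- Let $\mathcal S_1=\{(-1,0),(0,-1),(1,1)\}$ and $\mathcal S_2=\{(1,0),(0,1),(-1,-1)\}$, and let the step set $\mathcal S$ be $\mathcal S_1$, $\mathcal S_2$ or $\mathcal S_1\cup\mathcal S_2$. Then $$xyQ(x,y)-\bar x\,Q(\bar x\bar y,y)+\bar y\,Q(\bar x\bar y,x)=\frac{xy-\bar x+\bar y-2tx\,A_{ -1}(x)\,Q(x,0)+t\epsilon\, Q(0,0)}{K(x,y)}.$$
   Context: $q(i,j;n)$ is the number of walks of length $n$ from $(0,0)$ with steps in $\mathcal S$, staying in $\{(i,j):i\ge0,j\ge0\}$, ending at $(i,j)$; $Q(x,y)\equiv Q(x,y;t)=\sum_{i,j,n}q(i,j;n)x^iy^jt^n$. Here $\bar x=1/x$, $\bar y=1/y$, $K(x,y)=1-t\sum_{(i,j)\in\mathcal S}x^iy^j$, $A_{ -1}(x)$ is the coefficient of $\bar y$ in $\sum_{(i,j)\in\mathcal S}x^iy^j$ (so $A_{ -1}(x)=1$ for $\mathcal S_1$, $A_{ -1}(x)=\bar x$ for $\mathcal S_2$, $A_{ -1}(x)=1+\bar x$ for $\mathcal S_1\cup\mathcal S_2$), and $\epsilon=1$ if $(-1,-1)\in\mathcal S$, $\epsilon=0$ otherwise. Substitutions such as $Q(\bar x\bar y,y)$ are performed coefficientwise in $t$. -}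

module Defs where

open import Data.Nat as ℕ using (ℕ; zero; suc)
open import Data.Integer as ℤ using (ℤ; +_; -_; _+_; _-_; _*_; 0ℤ; 1ℤ; -1ℤ)
open import Data.Product using (_×_; _,_)
open import Data.List using (List; []; _∷_; _++_; [_]; map; concatMap; foldr; length; filterᵇ)
open import Data.Bool.ListAction using (any)
open import Data.Bool using (Bool; true; false; _∧_; if_then_else_)
open import Relation.Nullary.Decidable using (⌊_⌋)

Step : Set
Step = ℤ × ℤ

data StepSet : Set where
  S₁ S₂ S₁∪S₂ : StepSet

steps : StepSet → List Step
steps S₁    = (-1ℤ , 0ℤ) ∷ (0ℤ , -1ℤ) ∷ (1ℤ , 1ℤ) ∷ []
steps S₂    = (1ℤ , 0ℤ) ∷ (0ℤ , 1ℤ) ∷ (-1ℤ , -1ℤ) ∷ []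
steps S₁∪S₂ = steps S₁ ++ steps S₂

_==ℤ_ : ℤ → ℤ → Bool
a ==ℤ b = ⌊ a ℤ.≟ b ⌋

words : List Step → ℕ → List (List Step)
words S zero    = [ [] ]
words S (suc n) = concatMap (λ s → map (s ∷_) (words S n)) S

inQuad : ℤ × ℤ → Bool
inQuad (i , j) = ⌊ 0ℤ ℤ.≤? i ⌋ ∧ ⌊ 0ℤ ℤ.≤? j ⌋

-- every vertex visited after the current position p lies in the quadrant
staysIn : ℤ × ℤ → List Step → Bool
staysIn p [] = true
staysIn (i , j) ((u , v) ∷ w) = inQuad (i + u , j + v) ∧ staysIn (i + u , j + v) w

endpoint : ℤ × ℤ → List Step → ℤ × ℤ
endpoint p [] = p
endpoint (i , j) ((u , v) ∷ w) = endpoint (i + u , j + v) w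

q : StepSet → ℤ → ℤ → ℕ → ℕ
q S i j n = length (filterᵇ good (words (steps S) n))
  where
  good : List Step → Bool
  good w with endpoint (0ℤ , 0ℤ) w
  ... | (e , f) = staysIn (0ℤ , 0ℤ) w ∧ ((e ==ℤ i) ∧ (f ==ℤ j))

-- Formal power series in t whose coefficients are Laurent polynomials in x,y,
-- represented by their coefficients:  F n a b = [t^n x^a y^b] F.

Ser : Set
Ser = ℕ → ℤ → ℤ → ℤ

_⊕_ : Ser → Ser → Ser
(F ⊕ G) n a b = F n a b + G n a b

_⊖_ : Ser → Ser → Ser
(F ⊖ G) n a b = F n a b - G n a b

scale : ℤ → Ser → Ser
scale c F n a b = c * F n a b

sumSer : List Ser → Ser
sumSer = foldr _⊕_ (λ _ _ _ → 0ℤ)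

-- multiplication by the monomial t^k x^c y^d
monoMul : ℕ → ℤ → ℤ → Ser → Ser
monoMul k c d F n a b with ℕ.compare n k
... | ℕ.less _ _    = 0ℤ
... | ℕ.equal _     = F 0 (a - c) (b - d)
... | ℕ.greater _ m = F (suc m) (a - c) (b - d)

Q : StepSet → Ser
Q S n a b = + q S a b n

-- substitution F(x,y) ↦ F(x̄ȳ, y): x^i y^j ↦ x^(-i) y^(j-i)
subst-x̄ȳ,y : Ser → Ser
subst-x̄ȳ,y F n a b = F n (- a) (b - a)

-- substitution F(x,y) ↦ F(x̄ȳ, x): x^i y^j ↦ x^(j-i) y^(-i)
subst-x̄ȳ,x : Ser → Ser
subst-x̄ȳ,x F n a b = F n (- b) (a - b)

at-y0 : Ser → Ser
at-y0 F n a b = if b ==ℤ 0ℤ then F n a 0ℤ else 0ℤ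

at-00 : Ser → Ser
at-00 F n a b = if (a ==ℤ 0ℤ) ∧ (b ==ℤ 0ℤ) then F n 0ℤ 0ℤ else 0ℤ

mono : ℤ → ℤ → Ser
mono c d zero    a b = if (a ==ℤ c) ∧ (b ==ℤ d) then 1ℤ else 0ℤ
mono c d (suc n) a b = 0ℤ

-- multiplication by A_{-1}(x) = coefficient of ȳ in Σ_{(u,v)∈S} x^u y^v
mulA₋₁ : StepSet → Ser → Ser
mulA₋₁ S F = sumSer (map (λ { (u , v) → monoMul 0 u 0ℤ F })
                         (filterᵇ (λ { (u , v) → v ==ℤ -1ℤ }) (steps S)))

ε : StepSet → ℤ
ε S = if any (λ { (u , v) → (u ==ℤ -1ℤ) ∧ (v ==ℤ -1ℤ) }) (steps S) then 1ℤ else 0ℤ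

-- Division by K(x,y) = 1 - t Σ_{(u,v)∈S} x^u y^v: the unique series D with
-- K·D = N, i.e. D = N + t (Σ_S x^u y^v) D, computed degree by degree in t.
divK : StepSet → Ser → Ser
divK S N zero    a b = N zero a b
divK S N (suc n) a b =
  N (suc n) a b + foldr (λ { (u , v) acc → divK S N n (a - u) (b - v) + acc }) 0ℤ (steps S)

LHS : StepSet → Ser
LHS S = (monoMul 0 1ℤ 1ℤ (Q S) ⊖ monoMul 0 -1ℤ 0ℤ (subst-x̄ȳ,y (Q S)))
        ⊕ monoMul 0 0ℤ -1ℤ (subst-x̄ȳ,x (Q S))

Numerator : StepSet → Ser
Numerator S =
  ((((mono 1ℤ 1ℤ ⊖ mono -1ℤ 0ℤ) ⊕ mono 0ℤ -1ℤ)
    ⊖ scale (+ 2) (monoMul 1 1ℤ 0ℤ (mulA₋₁ S (at-y0 (Q S)))))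
   ⊕ scale (ε S) (monoMul 1 0ℤ 0ℤ (at-00 (Q S))))

RHS : StepSet → Ser
RHS S = divK S (Numerator S)

module Submission where

-- Write f_m(i,j) = q(i,j;m).  Every coefficient identity is
-- proved for each power t^n separately, so the theorem is a statement about
-- integer arrays.  Division by K is characterised by its recurrence
-- (divK-unique), so it suffices that the left-hand side L satisfies
-- L_0 = N_0 and L_{m+1} = N_{m+1} + Σ_{s∈S} x^s L_m, N being the numerator.
--   1. Counting walks by their last step gives the quarter-plane recurrence
--      f_{m+1} = (convolution of f_m with S) − (its part outside the quadrant).
--   2. The coefficient of x^a y^b in L_m is the signed sum of f_m over an
--      orbit of three points (orbit).  Since each step set is invariant under
--      the group of the walk, orbit sums commute with the convolution.
--   3. The part outside the quadrant (the defect) is supported on the lines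
--      i = -1 and j = -1; its orbit sum leaves only the terms with b = 0 and
--      the corner, which are exactly -N_{m+1} (using f(i,j) = f(j,i)).

open import Defs
open import Data.Nat using (ℕ)
open import Data.Integer using (ℤ)
open import Relation.Binary.PropositionalEquality using (_≡_)
open import Data.Nat using (zero; suc)
open import Data.Integer as ℤ using (+_; -[1+_]; -_; _+_; _-_; _*_; 0ℤ; 1ℤ; -1ℤ)
import Data.Integer.Properties as ℤP
open import Data.Integer.Tactic.RingSolver using (solve-∀)
open import Data.Product using (_×_; _,_)
open import Data.List using (List; []; _∷_; _++_; map; concatMap; length; filterᵇ)
open import Data.Bool using (Bool; true; false; _∧_; not; if_then_else_)
open import Data.Bool.Properties using (∧-assoc; ∧-comm; ∧-zeroʳ)
open import Data.Empty using (⊥-elim)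
open import Relation.Nullary.Decidable using (⌊_⌋; yes; no)
open import Relation.Binary.PropositionalEquality
  using (refl; sym; trans; cong; cong₂; module ≡-Reasoning)

-- ind b x is x if b holds and 0 otherwise.  The indicator series of Defs
-- (mono, at-y0, at-00) are of this shape by definition.
ind : Bool → ℤ → ℤ
ind b x = if b then x else 0ℤ

ind-0 : ∀ b → ind b 0ℤ ≡ 0ℤ
ind-0 true  = refl
ind-0 false = refl

ind-+ : ∀ b x y → ind b (x + y) ≡ ind b x + ind b y
ind-+ true  x y = refl
ind-+ false x y = refl

ind-comm : ∀ b c x → ind b (ind c x) ≡ ind c (ind b x)
ind-comm true  c     x = refl
ind-comm false true  x = refl
ind-comm false false x = refl

ind-∧ : ∀ b c x → ind (b ∧ c) x ≡ ind b (ind c x)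
ind-∧ true  c x = refl
ind-∧ false c x = refl

ind-complement : ∀ b x → ind b x ≡ x - ind (not b) x
ind-complement true  x = sym (ℤP.+-identityʳ x)
ind-complement false x = sym (ℤP.+-inverseʳ x)

==ℤ-cong : ∀ {x y x′ y′} → (x ≡ y → x′ ≡ y′) → (x′ ≡ y′ → x ≡ y) →
           (x ==ℤ y) ≡ (x′ ==ℤ y′)
==ℤ-cong {x} {y} {x′} {y′} to from with x ℤ.≟ y | x′ ℤ.≟ y′
... | yes _  | yes _  = refl
... | no _   | no _   = refl
... | yes eq | no neq = ⊥-elim (neq (to eq))
... | no neq | yes eq = ⊥-elim (neq (from eq))

==ℤ-sym : ∀ x y → (x ==ℤ y) ≡ (y ==ℤ x)
==ℤ-sym x y = ==ℤ-cong sym sym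

==ℤ-injective : (φ ψ : ℤ → ℤ) → (∀ z → ψ (φ z) ≡ z) →
                ∀ x y → (φ x ==ℤ φ y) ≡ (x ==ℤ y)
==ℤ-injective φ ψ ψφ x y = ==ℤ-cong
  (λ eq → trans (sym (ψφ x)) (trans (cong ψ eq) (ψφ y)))
  (cong φ)

ind-subst : ∀ x y (g : ℤ → ℤ) → ind (x ==ℤ y) (g x) ≡ ind (x ==ℤ y) (g y)
ind-subst x y g with x ℤ.≟ y
... | yes refl = refl
... | no _     = refl

∧-subst : ∀ x y (h : ℤ → Bool) → (x ==ℤ y) ∧ h x ≡ (x ==ℤ y) ∧ h y
∧-subst x y h with x ℤ.≟ y
... | yes refl = refl
... | no _     = refl

sumSteps : List Step → (ℤ → ℤ → ℤ) → ℤ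
sumSteps []            g = 0ℤ
sumSteps ((u , v) ∷ L) g = g u v + sumSteps L g

syntax sumSteps L (λ u v → e) = Σ[ u , v ∈ L ] e

Σ-cong : ∀ L {g h : ℤ → ℤ → ℤ} → (∀ u v → g u v ≡ h u v) →
         Σ[ u , v ∈ L ] g u v ≡ Σ[ u , v ∈ L ] h u v
Σ-cong []            eq = refl
Σ-cong ((u , v) ∷ L) eq = cong₂ _+_ (eq u v) (Σ-cong L eq)

Σ-0 : ∀ L → Σ[ u , v ∈ L ] 0ℤ ≡ 0ℤ
Σ-0 []            = refl
Σ-0 ((u , v) ∷ L) = trans (ℤP.+-identityˡ _) (Σ-0 L)

Σ-+ : ∀ L (g h : ℤ → ℤ → ℤ) →
      Σ[ u , v ∈ L ] (g u v + h u v) ≡ Σ[ u , v ∈ L ] g u v + Σ[ u , v ∈ L ] h u v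
Σ-+ []            g h = refl
Σ-+ ((u , v) ∷ L) g h =
  trans (cong (λ z → g u v + h u v + z) (Σ-+ L g h))
        (interchange (g u v) (h u v) (Σ[ u , v ∈ L ] g u v) (Σ[ u , v ∈ L ] h u v))
  where
  interchange : ∀ a b c d → a + b + (c + d) ≡ a + c + (b + d)
  interchange = solve-∀

Σ-orbit : ∀ L (g h k : ℤ → ℤ → ℤ) →
  Σ[ u , v ∈ L ] (g u v - h u v + k u v)
    ≡ Σ[ u , v ∈ L ] g u v - Σ[ u , v ∈ L ] h u v + Σ[ u , v ∈ L ] k u v
Σ-orbit []            g h k = refl
Σ-orbit ((u , v) ∷ L) g h k =
  trans (cong (λ z → g u v - h u v + k u v + z) (Σ-orbit L g h k))
        (regroup (g u v) (h u v) (k u v) (Σ[ u , v ∈ L ] g u v) (Σ[ u , v ∈ L ] h u v)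
                 (Σ[ u , v ∈ L ] k u v))
  where
  regroup : ∀ a b c d e f → a - b + c + (d - e + f) ≡ a + d - (b + e) + (c + f)
  regroup = solve-∀

Σ-ind : ∀ L b (g : ℤ → ℤ → ℤ) →
        Σ[ u , v ∈ L ] ind b (g u v) ≡ ind b (Σ[ u , v ∈ L ] g u v)
Σ-ind []            b g = sym (ind-0 b)
Σ-ind ((u , v) ∷ L) b g =
  trans (cong (λ z → ind b (g u v) + z) (Σ-ind L b g)) (sym (ind-+ b _ _))

Σ-swap : ∀ L M (h : ℤ → ℤ → ℤ → ℤ → ℤ) →
  Σ[ u , v ∈ L ] Σ[ u′ , v′ ∈ M ] h u v u′ v′ ≡ Σ[ u′ , v′ ∈ M ] Σ[ u , v ∈ L ] h u v u′ v′
Σ-swap []            M h = sym (Σ-0 M)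
Σ-swap ((u , v) ∷ L) M h =
  trans (cong (λ z → Σ[ u′ , v′ ∈ M ] h u v u′ v′ + z) (Σ-swap L M h))
        (sym (Σ-+ M (h u v) (λ u′ v′ → Σ[ u , v ∈ L ] h u v u′ v′)))

Σ-++ : ∀ L M (g : ℤ → ℤ → ℤ) →
       Σ[ u , v ∈ L ++ M ] g u v ≡ Σ[ u , v ∈ L ] g u v + Σ[ u , v ∈ M ] g u v
Σ-++ []            M g = sym (ℤP.+-identityˡ _)
Σ-++ ((u , v) ∷ L) M g =
  trans (cong (λ z → g u v + z) (Σ-++ L M g)) (sym (ℤP.+-assoc (g u v) _ _))

count : {A : Set} → (A → Bool) → List A → ℤ
count p []       = 0ℤ
count p (x ∷ xs) = if p x then 1ℤ + count p xs else count p xs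

length-filter : {A : Set} (p : A → Bool) (xs : List A) →
                + length (filterᵇ p xs) ≡ count p xs
length-filter p []       = refl
length-filter p (x ∷ xs) with p x
... | true  = cong (λ z → 1ℤ + z) (length-filter p xs)
... | false = length-filter p xs

count-++ : {A : Set} (p : A → Bool) (xs ys : List A) →
           count p (xs ++ ys) ≡ count p xs + count p ys
count-++ p []       ys = sym (ℤP.+-identityˡ _)
count-++ p (x ∷ xs) ys with p x
... | true  = trans (cong (λ z → 1ℤ + z) (count-++ p xs ys)) (sym (ℤP.+-assoc 1ℤ (count p xs) (count p ys)))
... | false = count-++ p xs ys

count-map : {A B : Set} (p : B → Bool) (f : A → B) (xs : List A) →
            count p (map f xs) ≡ count (λ x → p (f x)) xs
count-map p f []       = refl
count-map p f (x ∷ xs) with p (f x)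
... | true  = cong (λ z → 1ℤ + z) (count-map p f xs)
... | false = count-map p f xs

count-cong : {A : Set} {p p′ : A → Bool} → (∀ x → p x ≡ p′ x) →
             (xs : List A) → count p xs ≡ count p′ xs
count-cong eq []       = refl
count-cong {p′ = p′} eq (x ∷ xs) rewrite eq x with p′ x
... | true  = cong (λ z → 1ℤ + z) (count-cong eq xs)
... | false = count-cong eq xs

count-guard : {A : Set} (b : Bool) (p : A → Bool) (xs : List A) →
              count (λ x → b ∧ p x) xs ≡ ind b (count p xs)
count-guard true  p xs       = refl
count-guard false p []       = refl
count-guard false p (x ∷ xs) = count-guard false p xs

_⊞_ : ℤ × ℤ → Step → ℤ × ℤ
(x , y) ⊞ (u , v) = (x + u , y + v)

arrives : ℤ × ℤ → ℤ → ℤ → List Step → Bool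
arrives p i j w with endpoint p w
... | (e , f) = staysIn p w ∧ ((e ==ℤ i) ∧ (f ==ℤ j))

walks : List Step → ℤ × ℤ → ℕ → ℤ → ℤ → ℤ
walks L p n i j = count (arrives p i j) (words L n)

Q-walks : ∀ S n i j → Q S n i j ≡ walks (steps S) (0ℤ , 0ℤ) n i j
Q-walks S n i j = length-filter _ (words (steps S) n)

walks-first : ∀ L M p n i j →
  count (arrives p i j) (concatMap (λ s → map (s ∷_) (words L n)) M)
    ≡ Σ[ u , v ∈ M ] ind (inQuad (p ⊞ (u , v))) (walks L (p ⊞ (u , v)) n i j)
walks-first L []            p n i j = refl
walks-first L ((u , v) ∷ M) p n i j =
  trans (count-++ (arrives p i j) (map ((u , v) ∷_) (words L n)) _)
        (cong₂ _+_ first (walks-first L M p n i j))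
  where
  first : count (arrives p i j) (map ((u , v) ∷_) (words L n))
            ≡ ind (inQuad (p ⊞ (u , v))) (walks L (p ⊞ (u , v)) n i j)
  first = trans (count-map (arrives p i j) ((u , v) ∷_) (words L n))
         (trans (count-cong (λ w → ∧-assoc (inQuad (p ⊞ (u , v))) _ _) (words L n))
                (count-guard (inQuad (p ⊞ (u , v))) (arrives (p ⊞ (u , v)) i j) (words L n)))

walks-suc : ∀ L p n i j →
  walks L p (suc n) i j ≡ Σ[ u , v ∈ L ] ind (inQuad (p ⊞ (u , v))) (walks L (p ⊞ (u , v)) n i j)
walks-suc L = walks-first L L

==ℤ-translate : ∀ x u i → ((x + u) ==ℤ i) ≡ (x ==ℤ (i - u))
==ℤ-translate x u i = ==ℤ-cong
  (λ eq → trans (cancel x u) (cong (_- u) eq))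
  (λ eq → trans (cong (_+ u) eq) (sym (cancel′ i u)))
  where
  cancel : ∀ x u → x ≡ x + u - u
  cancel = solve-∀
  cancel′ : ∀ i u → i ≡ i - u + u
  cancel′ = solve-∀

ind-at-point : ∀ x y i j (h : ℤ × ℤ → Bool) z →
  ind (h (x , y)) (ind ((x ==ℤ i) ∧ (y ==ℤ j)) z) ≡ ind (h (i , j)) (ind ((x ==ℤ i) ∧ (y ==ℤ j)) z)
ind-at-point x y i j h z with x ℤ.≟ i | y ℤ.≟ j
... | yes refl | yes refl = refl
... | yes refl | no _     = trans (ind-0 (h (x , y))) (sym (ind-0 (h (i , j))))
... | no _     | _        = trans (ind-0 (h (x , y))) (sym (ind-0 (h (i , j))))

-- For one-step walks
-- this is the translation of the arrival test; in general it follows by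
-- induction, peeling off the first step and exchanging the two sums.
walks-last : ∀ L n p i j →
  walks L p (suc n) i j ≡ ind (inQuad (i , j)) (Σ[ u , v ∈ L ] walks L p n (i - u) (j - v))
walks-last L zero (x , y) i j =
  trans (walks-suc L (x , y) 0 i j)
  (trans (Σ-cong L last-step) (Σ-ind L (inQuad (i , j)) _))
  where
  last-step : ∀ u v → ind (inQuad (x + u , y + v)) (walks L (x + u , y + v) 0 i j)
                        ≡ ind (inQuad (i , j)) (walks L (x , y) 0 (i - u) (j - v))
  last-step u v =
    trans (ind-at-point (x + u) (y + v) i j inQuad 1ℤ)
          (cong₂ (λ b c → ind (inQuad (i , j)) (ind (b ∧ c) 1ℤ))
                 (==ℤ-translate x u i) (==ℤ-translate y v j))
walks-last L (suc n) p i j = begin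
  walks L p (suc (suc n)) i j
    ≡⟨ walks-suc L p (suc n) i j ⟩
  Σ[ u , v ∈ L ] ind (inQuad (p ⊞ (u , v))) (walks L (p ⊞ (u , v)) (suc n) i j)
    ≡⟨ Σ-cong L (λ u v → cong (ind (inQuad (p ⊞ (u , v)))) (walks-last L n (p ⊞ (u , v)) i j)) ⟩
  Σ[ u , v ∈ L ] ind (inQuad (p ⊞ (u , v))) (ind (inQuad (i , j)) (inner u v))
    ≡⟨ Σ-cong L (λ u v → ind-comm (inQuad (p ⊞ (u , v))) (inQuad (i , j)) (inner u v)) ⟩
  Σ[ u , v ∈ L ] ind (inQuad (i , j)) (ind (inQuad (p ⊞ (u , v))) (inner u v))
    ≡⟨ Σ-ind L (inQuad (i , j)) _ ⟩
  ind (inQuad (i , j)) (Σ[ u , v ∈ L ] ind (inQuad (p ⊞ (u , v))) (inner u v))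
    ≡⟨ cong (ind (inQuad (i , j))) (Σ-cong L (λ u v → sym (Σ-ind L (inQuad (p ⊞ (u , v))) _))) ⟩
  ind (inQuad (i , j)) (Σ[ u , v ∈ L ] Σ[ u′ , v′ ∈ L ] ind (inQuad (p ⊞ (u , v)))
                                                           (walks L (p ⊞ (u , v)) n (i - u′) (j - v′)))
    ≡⟨ cong (ind (inQuad (i , j))) (Σ-swap L L _) ⟩
  ind (inQuad (i , j)) (Σ[ u′ , v′ ∈ L ] Σ[ u , v ∈ L ] ind (inQuad (p ⊞ (u , v)))
                                                           (walks L (p ⊞ (u , v)) n (i - u′) (j - v′)))
    ≡⟨ cong (ind (inQuad (i , j))) (Σ-cong L (λ u′ v′ → sym (walks-suc L p n (i - u′) (j - v′)))) ⟩
  ind (inQuad (i , j)) (Σ[ u′ , v′ ∈ L ] walks L p (suc n) (i - u′) (j - v′)) ∎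
  where
  open ≡-Reasoning
  inner : ℤ → ℤ → ℤ
  inner u v = Σ[ u′ , v′ ∈ L ] walks L (p ⊞ (u , v)) n (i - u′) (j - v′)

Q-zero : ∀ S i j → Q S 0 i j ≡ ind ((0ℤ ==ℤ i) ∧ (0ℤ ==ℤ j)) 1ℤ
Q-zero S i j = Q-walks S 0 i j

Q-suc : ∀ S m i j →
        Q S (suc m) i j ≡ ind (inQuad (i , j)) (Σ[ u , v ∈ steps S ] Q S m (i - u) (j - v))
Q-suc S m i j =
  trans (Q-walks S (suc m) i j)
  (trans (walks-last (steps S) m (0ℤ , 0ℤ) i j)
         (cong (ind (inQuad (i , j)))
               (Σ-cong (steps S) (λ u v → sym (Q-walks S m (i - u) (j - v))))))

Fn : Set
Fn = ℤ → ℤ → ℤ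

record Vanishing (f : Fn) : Set where
  field
    at-negative-x : ∀ k j → f -[1+ k ] j ≡ 0ℤ
    at-negative-y : ∀ i k → f i -[1+ k ] ≡ 0ℤ
open Vanishing

Q-vanishing : ∀ S m → Vanishing (Q S m)
Q-vanishing S zero .at-negative-x k j = Q-zero S -[1+ k ] j
Q-vanishing S zero .at-negative-y i k =
  trans (Q-zero S i -[1+ k ]) (cong (λ b → ind b 1ℤ) (∧-zeroʳ (0ℤ ==ℤ i)))
Q-vanishing S (suc m) .at-negative-x k j = Q-suc S m -[1+ k ] j
Q-vanishing S (suc m) .at-negative-y i k =
  trans (Q-suc S m i -[1+ k ])
        (cong (λ b → ind b (Σ[ u , v ∈ steps S ] Q S m (i - u) (-[1+ k ] - v)))
              (∧-zeroʳ ⌊ 0ℤ ℤP.≤? i ⌋))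

-- Each step set is invariant under the diagonal reflection (u, v) ↦ (v, u)
-- and under the maps (u, v) ↦ (-u, v - u) and (u, v) ↦ (-v, u - v), which
-- generate the group of the walk; so sums over the steps are too.
module _ where
  private
    exchange₃ : ∀ a b c → b + (a + (c + 0ℤ)) ≡ a + (b + (c + 0ℤ))
    exchange₃ = solve-∀
    exchange₆ : ∀ a b c d e f →
      b + (a + (c + (e + (d + (f + 0ℤ))))) ≡ a + (b + (c + (d + (e + (f + 0ℤ)))))
    exchange₆ = solve-∀
    reverse₃ : ∀ a b c → c + (b + (a + 0ℤ)) ≡ a + (b + (c + 0ℤ))
    reverse₃ = solve-∀
    reverse₆ : ∀ a b c d e f →
      c + (b + (a + (f + (e + (d + 0ℤ))))) ≡ a + (b + (c + (d + (e + (f + 0ℤ)))))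
    reverse₆ = solve-∀
    rotate₃ : ∀ a b c → b + (c + (a + 0ℤ)) ≡ a + (b + (c + 0ℤ))
    rotate₃ = solve-∀
    rotate₆ : ∀ a b c d e f →
      b + (c + (a + (e + (f + (d + 0ℤ))))) ≡ a + (b + (c + (d + (e + (f + 0ℤ)))))
    rotate₆ = solve-∀

  Σ-swap-invariant : ∀ S (g : Fn) → Σ[ u , v ∈ steps S ] g v u ≡ Σ[ u , v ∈ steps S ] g u v
  Σ-swap-invariant S₁    g = exchange₃ (g -1ℤ 0ℤ) (g 0ℤ -1ℤ) (g 1ℤ 1ℤ)
  Σ-swap-invariant S₂    g = exchange₃ (g 1ℤ 0ℤ) (g 0ℤ 1ℤ) (g -1ℤ -1ℤ)
  Σ-swap-invariant S₁∪S₂ g =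
    exchange₆ (g -1ℤ 0ℤ) (g 0ℤ -1ℤ) (g 1ℤ 1ℤ) (g 1ℤ 0ℤ) (g 0ℤ 1ℤ) (g -1ℤ -1ℤ)

  Σ-σ-invariant : ∀ S (g : Fn) → Σ[ u , v ∈ steps S ] g (- u) (v - u) ≡ Σ[ u , v ∈ steps S ] g u v
  Σ-σ-invariant S₁    g = reverse₃ (g -1ℤ 0ℤ) (g 0ℤ -1ℤ) (g 1ℤ 1ℤ)
  Σ-σ-invariant S₂    g = reverse₃ (g 1ℤ 0ℤ) (g 0ℤ 1ℤ) (g -1ℤ -1ℤ)
  Σ-σ-invariant S₁∪S₂ g =
    reverse₆ (g -1ℤ 0ℤ) (g 0ℤ -1ℤ) (g 1ℤ 1ℤ) (g 1ℤ 0ℤ) (g 0ℤ 1ℤ) (g -1ℤ -1ℤ)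

  Σ-τ-invariant : ∀ S (g : Fn) → Σ[ u , v ∈ steps S ] g (- v) (u - v) ≡ Σ[ u , v ∈ steps S ] g u v
  Σ-τ-invariant S₁    g = rotate₃ (g -1ℤ 0ℤ) (g 0ℤ -1ℤ) (g 1ℤ 1ℤ)
  Σ-τ-invariant S₂    g = rotate₃ (g 1ℤ 0ℤ) (g 0ℤ 1ℤ) (g -1ℤ -1ℤ)
  Σ-τ-invariant S₁∪S₂ g =
    rotate₆ (g -1ℤ 0ℤ) (g 0ℤ -1ℤ) (g 1ℤ 1ℤ) (g 1ℤ 0ℤ) (g 0ℤ 1ℤ) (g -1ℤ -1ℤ)

-- Q(x, y) = Q(y, x), since the step sets are symmetric in the diagonal.
Q-symmetric : ∀ S m i j → Q S m i j ≡ Q S m j i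
Q-symmetric S zero i j =
  trans (Q-zero S i j)
  (trans (cong (λ b → ind b 1ℤ) (∧-comm (0ℤ ==ℤ i) (0ℤ ==ℤ j))) (sym (Q-zero S j i)))
Q-symmetric S (suc m) i j =
  trans (Q-suc S m i j)
  (trans (cong₂ ind (∧-comm ⌊ 0ℤ ℤP.≤? i ⌋ ⌊ 0ℤ ℤP.≤? j ⌋)
                    (trans (Σ-swap-invariant S (λ u v → Q S m (i - v) (j - u)))
                           (Σ-cong (steps S) (λ u v → Q-symmetric S m (i - v) (j - u)))))
         (sym (Q-suc S m j i)))

-- The defect of the step (u, v) at (i, j): the term f(i - u, j - v) that the
-- unconstrained recurrence would place at (i, j) although (i, j) lies
-- outside the quadrant.
δ : Step → Fn → Fn
δ (u , v) f i j = ind (not (inQuad (i , j))) (f (i - u) (j - v))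

defect : StepSet → Fn → Fn
defect S f i j = Σ[ u , v ∈ steps S ] δ (u , v) f i j

Q-suc-defect : ∀ S m i j →
  Q S (suc m) i j ≡ Σ[ u , v ∈ steps S ] Q S m (i - u) (j - v) - defect S (Q S m) i j
Q-suc-defect S m i j =
  trans (Q-suc S m i j)
  (trans (ind-complement (inQuad (i , j)) _)
         (cong (λ d → Σ[ u , v ∈ steps S ] Q S m (i - u) (j - v) - d)
               (sym (Σ-ind (steps S) (not (inQuad (i , j))) (λ u v → Q S m (i - u) (j - v))))))

-- For f vanishing outside the quadrant, the defects of the individual steps
-- have closed forms.  A step with nonnegative coordinates cannot leave the
-- quadrant, so it has no defect.
δ-outward : ∀ {f} → Vanishing f → ∀ u v i j → δ (+ u , + v) f i j ≡ 0ℤ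
δ-outward         V u v (+ k) (+ l)    = refl
δ-outward {f = f} V u v (+ k) -[1+ l ] =
  trans (cong (λ b → ind (not b) (f (+ k - + u) (-[1+ l ] - + v))) (∧-zeroʳ ⌊ 0ℤ ℤP.≤? + k ⌋))
        (trans (cong (f (+ k - + u)) (ℤP.neg-minus-pos l v)) (V .at-negative-y _ _))
δ-outward {f = f} V u v -[1+ k ] j     =
  trans (cong (λ x → f x (j - + v)) (ℤP.neg-minus-pos k u)) (V .at-negative-x _ _)

along-x : (ℤ → ℤ) → Fn
along-x h i j = ind (i ==ℤ -1ℤ) (h j)

along-y : (ℤ → ℤ) → Fn
along-y h i j = ind (j ==ℤ -1ℤ) (h i)

δ-left : ∀ {f} → Vanishing f → ∀ i j → δ (-1ℤ , 0ℤ) f i j ≡ along-x (f 0ℤ) i j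
δ-left         V (+ k)          (+ l)    = refl
δ-left {f = f} V (+ k)          -[1+ l ] =
  trans (cong (ind (not (⌊ 0ℤ ℤP.≤? + k ⌋ ∧ false))) (V .at-negative-y _ l))
        (ind-0 (not (⌊ 0ℤ ℤP.≤? + k ⌋ ∧ false)))
δ-left {f = f} V -[1+ 0 ]       j        = cong (f 0ℤ) (ℤP.+-identityʳ j)
δ-left         V -[1+ suc k ]   j        = V .at-negative-x k _

δ-down : ∀ {f} → Vanishing f → ∀ i j → δ (0ℤ , -1ℤ) f i j ≡ along-y (λ i → f i 0ℤ) i j
δ-down         V (+ k)    (+ l)          = refl
δ-down {f = f} V (+ k)    -[1+ 0 ]       =
  trans (cong (λ b → ind (not b) (f (+ k - 0ℤ) 0ℤ)) (∧-zeroʳ ⌊ 0ℤ ℤP.≤? + k ⌋))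
        (cong (λ x → f x 0ℤ) (ℤP.+-identityʳ (+ k)))
δ-down {f = f} V (+ k)    -[1+ suc l ]   =
  trans (cong (ind (not (⌊ 0ℤ ℤP.≤? + k ⌋ ∧ false))) (V .at-negative-y _ l))
        (ind-0 (not (⌊ 0ℤ ℤP.≤? + k ⌋ ∧ false)))
δ-down {f = f} V -[1+ k ] j              =
  trans (V .at-negative-x k _)
        (sym (trans (cong (ind (j ==ℤ -1ℤ)) (V .at-negative-x k 0ℤ)) (ind-0 (j ==ℤ -1ℤ))))

-- The step (-1, -1) leaves the quadrant across either line; the corner
-- (-1, -1) is counted by inclusion–exclusion.
corner : Fn → Fn
corner f i j = along-x (λ j → f 0ℤ (j - -1ℤ)) i j + along-y (λ i → f (i - -1ℤ) 0ℤ) i j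
             - along-x (λ j → ind (j ==ℤ -1ℤ) (f 0ℤ 0ℤ)) i j

δ-corner : ∀ {f} → Vanishing f → ∀ i j → δ (-1ℤ , -1ℤ) f i j ≡ corner f i j
δ-corner         V (+ k)        (+ l)          = refl
δ-corner {f = f} V (+ k)        -[1+ 0 ]       =
  trans (cong (λ b → ind (not b) (f (+ k - -1ℤ) 0ℤ)) (∧-zeroʳ ⌊ 0ℤ ℤP.≤? + k ⌋))
        (middle (f (+ k - -1ℤ) 0ℤ))
  where
  middle : ∀ x → x ≡ 0ℤ + x - 0ℤ
  middle = solve-∀
δ-corner         V (+ k)        -[1+ suc l ]   =
  trans (cong (ind (not (⌊ 0ℤ ℤP.≤? + k ⌋ ∧ false))) (V .at-negative-y _ l))
        (ind-0 (not (⌊ 0ℤ ℤP.≤? + k ⌋ ∧ false)))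
δ-corner {f = f} V -[1+ 0 ]     (+ l)          = first (f 0ℤ (+ l - -1ℤ))
  where
  first : ∀ x → x ≡ x + 0ℤ - 0ℤ
  first = solve-∀
δ-corner {f = f} V -[1+ 0 ]     -[1+ 0 ]       = both (f 0ℤ 0ℤ)
  where
  both : ∀ x → x ≡ x + x - x
  both = solve-∀
δ-corner {f = f} V -[1+ 0 ]     -[1+ suc l ]   =
  trans (V .at-negative-y 0ℤ l) (cong (λ x → x + 0ℤ - 0ℤ) (sym (V .at-negative-y 0ℤ l)))
δ-corner {f = f} V -[1+ suc k ] j              =
  trans (V .at-negative-x k _)
        (sym (cong (λ x → 0ℤ + x - 0ℤ)
                   (trans (cong (ind (j ==ℤ -1ℤ)) (V .at-negative-x k 0ℤ)) (ind-0 (j ==ℤ -1ℤ)))))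

defect-S₁ : ∀ {f} → Vanishing f → ∀ i j →
            defect S₁ f i j ≡ along-x (f 0ℤ) i j + along-y (λ i → f i 0ℤ) i j
defect-S₁ {f} V i j =
  trans (cong₂ _+_ (δ-left V i j)
                   (cong₂ _+_ (δ-down V i j) (cong (λ z → z + 0ℤ) (δ-outward V 1 1 i j))))
        (cong (λ z → along-x (f 0ℤ) i j + z) (ℤP.+-identityʳ (along-y (λ i → f i 0ℤ) i j)))

defect-S₂ : ∀ {f} → Vanishing f → ∀ i j → defect S₂ f i j ≡ corner f i j
defect-S₂ V i j =
  trans (cong₂ _+_ (δ-outward V 1 0 i j)
                   (cong₂ _+_ (δ-outward V 0 1 i j) (cong (λ z → z + 0ℤ) (δ-corner V i j))))
        (only-corner _)
  where
  only-corner : ∀ x → 0ℤ + (0ℤ + (x + 0ℤ)) ≡ x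
  only-corner = solve-∀

defect-S₁∪S₂ : ∀ f i j → defect S₁∪S₂ f i j ≡ defect S₁ f i j + defect S₂ f i j
defect-S₁∪S₂ f i j = Σ-++ (steps S₁) (steps S₂) (λ u v → δ (u , v) f i j)

-- The coefficient of x^a y^b in  x y F(x,y) - x̄ F(x̄ȳ,y) + ȳ F(x̄ȳ,x)  is
-- orbit F a b: a signed sum of F over three points related by the group of
-- the walk.
x₁ : ℤ → ℤ
x₁ a = a - 1ℤ

x₂ : ℤ → ℤ
x₂ a = - (a - -1ℤ)

y₂ : ℤ → ℤ → ℤ
y₂ a b = (b - 0ℤ) - (a - -1ℤ)

orbit : Fn → Fn
orbit g a b = g (x₁ a) (x₁ b) - g (x₂ a) (y₂ a b) + g (x₂ b) (y₂ b a)

LHS-orbit : ∀ S m a b → LHS S m a b ≡ orbit (Q S m) a b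
LHS-orbit S zero    a b = refl
LHS-orbit S (suc m) a b = refl

orbit-cong : ∀ {g h : Fn} → (∀ i j → g i j ≡ h i j) → ∀ a b → orbit g a b ≡ orbit h a b
orbit-cong eq a b =
  cong₂ _+_ (cong₂ _-_ (eq (x₁ a) (x₁ b)) (eq (x₂ a) (y₂ a b))) (eq (x₂ b) (y₂ b a))

orbit-+ : ∀ (g h : Fn) a b → orbit (λ i j → g i j + h i j) a b ≡ orbit g a b + orbit h a b
orbit-+ g h a b =
  regroup (g (x₁ a) (x₁ b)) (h (x₁ a) (x₁ b)) (g (x₂ a) (y₂ a b)) (h (x₂ a) (y₂ a b))
          (g (x₂ b) (y₂ b a)) (h (x₂ b) (y₂ b a))
  where
  regroup : ∀ p q r s t w → p + q - (r + s) + (t + w) ≡ p - r + t + (q - s + w)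
  regroup = solve-∀

orbit-- : ∀ (g h : Fn) a b → orbit (λ i j → g i j - h i j) a b ≡ orbit g a b - orbit h a b
orbit-- g h a b =
  regroup (g (x₁ a) (x₁ b)) (h (x₁ a) (x₁ b)) (g (x₂ a) (y₂ a b)) (h (x₂ a) (y₂ a b))
          (g (x₂ b) (y₂ b a)) (h (x₂ b) (y₂ b a))
  where
  regroup : ∀ p q r s t w → p - q - (r - s) + (t - w) ≡ p - r + t - (q - s + w)
  regroup = solve-∀

-- Translating (a, b) by a step translates the orbit points by the images of
-- the step under the group of the walk; by invariance of the step sets,
-- forming orbits commutes with convolution by the steps.
orbit-convolution : ∀ S (f : Fn) a b →
  Σ[ u , v ∈ steps S ] orbit f (a - u) (b - v)
    ≡ orbit (λ i j → Σ[ u , v ∈ steps S ] f (i - u) (j - v)) a b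
orbit-convolution S f a b =
  trans (Σ-orbit (steps S) _ _ _)
        (cong₂ _+_ (cong₂ _-_ (Σ-cong (steps S) (λ u v → cong₂ f (x₁-shift a u) (x₁-shift b v)))
                              (trans (Σ-cong (steps S) (λ u v → cong₂ f (x₂-shift a u) (y₂-shift a b u v)))
                                     (Σ-σ-invariant S (λ u v → f (x₂ a - u) (y₂ a b - v)))))
                   (trans (Σ-cong (steps S) (λ u v → cong₂ f (x₂-shift b v) (y₂-shift b a v u)))
                          (Σ-τ-invariant S (λ u v → f (x₂ b - u) (y₂ b a - v)))))
  where
  x₁-shift : ∀ a u → (a - u) - 1ℤ ≡ (a - 1ℤ) - u
  x₁-shift = solve-∀
  x₂-shift : ∀ a u → - ((a - u) - -1ℤ) ≡ - (a - -1ℤ) - (- u)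
  x₂-shift = solve-∀
  y₂-shift : ∀ a b u v → ((b - v) - 0ℤ) - ((a - u) - -1ℤ) ≡ ((b - 0ℤ) - (a - -1ℤ)) - (v - u)
  y₂-shift = solve-∀

x₁-on-line : ∀ a → (x₁ a ==ℤ -1ℤ) ≡ (a ==ℤ 0ℤ)
x₁-on-line a = ==ℤ-injective x₁ (λ z → z + 1ℤ) inverse a 0ℤ
  where
  inverse : ∀ z → z - 1ℤ + 1ℤ ≡ z
  inverse = solve-∀

x₂-on-line : ∀ a → (x₂ a ==ℤ -1ℤ) ≡ (a ==ℤ 0ℤ)
x₂-on-line a = ==ℤ-injective x₂ (λ z → - z - 1ℤ) inverse a 0ℤ
  where
  inverse : ∀ z → - (- (z - -1ℤ)) - 1ℤ ≡ z
  inverse = solve-∀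

y₂-on-line : ∀ a b → (y₂ a b ==ℤ -1ℤ) ≡ (b ==ℤ a)
y₂-on-line a b =
  trans (cong (y₂ a b ==ℤ_) (diagonal a))
        (==ℤ-injective (λ z → y₂ a z) (λ z → z + (a - -1ℤ)) (inverse a) b a)
  where
  diagonal : ∀ a → -1ℤ ≡ (a - 0ℤ) - (a - -1ℤ)
  diagonal = solve-∀
  inverse : ∀ a z → (z - 0ℤ) - (a - -1ℤ) + (a - -1ℤ) ≡ z
  inverse = solve-∀

y₂-at-0 : ∀ b → y₂ 0ℤ b ≡ x₁ b
y₂-at-0 b = cong (λ z → z - 1ℤ) (ℤP.+-identityʳ b)

-- Orbits of arrays supported on the boundary lines.  In both cases two of
-- the three orbit points cancel and only the line b = 0 survives.
orbit-along-x : ∀ h a b → orbit (along-x h) a b ≡ ind (b ==ℤ 0ℤ) (h (x₁ a))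
orbit-along-x h a b = begin
  ind (x₁ a ==ℤ -1ℤ) (h (x₁ b)) - ind (x₂ a ==ℤ -1ℤ) (h (y₂ a b))
    + ind (x₂ b ==ℤ -1ℤ) (h (y₂ b a))
    ≡⟨ cong₂ _+_ (cong₂ _-_ (cong (λ t → ind t (h (x₁ b))) (x₁-on-line a)) (second a b))
                 (second b a) ⟩
  ind (a ==ℤ 0ℤ) (h (x₁ b)) - ind (a ==ℤ 0ℤ) (h (x₁ b)) + ind (b ==ℤ 0ℤ) (h (x₁ a))
    ≡⟨ cancel (ind (a ==ℤ 0ℤ) (h (x₁ b))) _ ⟩
  ind (b ==ℤ 0ℤ) (h (x₁ a)) ∎
  where
  open ≡-Reasoning
  second : ∀ a b → ind (x₂ a ==ℤ -1ℤ) (h (y₂ a b)) ≡ ind (a ==ℤ 0ℤ) (h (x₁ b))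
  second a b =
    trans (cong (λ t → ind t (h (y₂ a b))) (x₂-on-line a))
          (trans (ind-subst a 0ℤ (λ z → h (y₂ z b))) (cong (λ z → ind (a ==ℤ 0ℤ) (h z)) (y₂-at-0 b)))
  cancel : ∀ p q → p - p + q ≡ q
  cancel = solve-∀

orbit-along-y : ∀ h a b → orbit (along-y h) a b ≡ ind (b ==ℤ 0ℤ) (h (x₁ a))
orbit-along-y h a b = begin
  ind (x₁ b ==ℤ -1ℤ) (h (x₁ a)) - ind (y₂ a b ==ℤ -1ℤ) (h (x₂ a))
    + ind (y₂ b a ==ℤ -1ℤ) (h (x₂ b))
    ≡⟨ cong₂ _+_ (cong₂ _-_ (cong (λ t → ind t (h (x₁ a))) (x₁-on-line b)) refl)
                 (sym (second a b)) ⟩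
  ind (b ==ℤ 0ℤ) (h (x₁ a)) - ind (y₂ a b ==ℤ -1ℤ) (h (x₂ a)) + ind (y₂ a b ==ℤ -1ℤ) (h (x₂ a))
    ≡⟨ cancel _ (ind (y₂ a b ==ℤ -1ℤ) (h (x₂ a))) ⟩
  ind (b ==ℤ 0ℤ) (h (x₁ a)) ∎
  where
  open ≡-Reasoning
  -- the second and third orbit points lie on j = -1 together, when a = b
  second : ∀ a b → ind (y₂ a b ==ℤ -1ℤ) (h (x₂ a)) ≡ ind (y₂ b a ==ℤ -1ℤ) (h (x₂ b))
  second a b =
    trans (cong (λ t → ind t (h (x₂ a))) (y₂-on-line a b))
    (trans (sym (ind-subst b a (λ z → h (x₂ z))))
    (trans (cong (λ t → ind t (h (x₂ b))) (==ℤ-sym b a))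
           (cong (λ t → ind t (h (x₂ b))) (sym (y₂-on-line b a)))))
  cancel : ∀ p q → p - q + q ≡ p
  cancel = solve-∀

on-axis : Fn → ℤ → ℤ → ℤ
on-axis f i b = ind (b ==ℤ 0ℤ) (f i 0ℤ)

module Boundary {f : Fn} (V : Vanishing f) (f-sym : ∀ i j → f i j ≡ f j i) (a b : ℤ) where

  boundary-S₁ : orbit (defect S₁ f) a b ≡ on-axis f (x₁ a) b + on-axis f (x₁ a) b
  boundary-S₁ =
    trans (orbit-cong (defect-S₁ V) a b)
    (trans (orbit-+ (along-x (f 0ℤ)) (along-y (λ i → f i 0ℤ)) a b)
           (cong₂ _+_ (trans (orbit-along-x (f 0ℤ) a b)
                             (cong (ind (b ==ℤ 0ℤ)) (f-sym 0ℤ (x₁ a))))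
                      (orbit-along-y (λ i → f i 0ℤ) a b)))

  boundary-S₂ : orbit (defect S₂ f) a b
                  ≡ on-axis f (x₁ a - -1ℤ) b + on-axis f (x₁ a - -1ℤ) b
                    - ind (a ==ℤ 0ℤ) (ind (b ==ℤ 0ℤ) (f 0ℤ 0ℤ))
  boundary-S₂ =
    trans (orbit-cong (defect-S₂ V) a b)
    (trans (orbit-- (λ i j → along-x (λ j → f 0ℤ (j - -1ℤ)) i j + along-y (λ i → f (i - -1ℤ) 0ℤ) i j)
                   (along-x (λ j → ind (j ==ℤ -1ℤ) (f 0ℤ 0ℤ))) a b)
    (cong₂ _-_
      (trans (orbit-+ (along-x (λ j → f 0ℤ (j - -1ℤ))) (along-y (λ i → f (i - -1ℤ) 0ℤ)) a b)
             (cong₂ _+_ (trans (orbit-along-x (λ j → f 0ℤ (j - -1ℤ)) a b)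
                               (cong (ind (b ==ℤ 0ℤ)) (f-sym 0ℤ (x₁ a - -1ℤ))))
                        (orbit-along-y (λ i → f (i - -1ℤ) 0ℤ) a b)))
      (trans (orbit-along-x (λ j → ind (j ==ℤ -1ℤ) (f 0ℤ 0ℤ)) a b)
      (trans (cong (λ t → ind (b ==ℤ 0ℤ) (ind t (f 0ℤ 0ℤ))) (x₁-on-line a))
             (ind-comm (b ==ℤ 0ℤ) (a ==ℤ 0ℤ) (f 0ℤ 0ℤ))))))

  boundary-S₁∪S₂ : orbit (defect S₁∪S₂ f) a b ≡ orbit (defect S₁ f) a b + orbit (defect S₂ f) a b
  boundary-S₁∪S₂ =
    trans (orbit-cong (defect-S₁∪S₂ f) a b) (orbit-+ (defect S₁ f) (defect S₂ f) a b)

numerator-suc : ∀ S m a b → Numerator S (suc m) a b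
  ≡ 0ℤ - (+ 2) * mulA₋₁ S (at-y0 (Q S)) m (x₁ a) (b - 0ℤ) + ε S * at-00 (Q S) m (a - 0ℤ) (b - 0ℤ)
numerator-suc S zero    a b = refl
numerator-suc S (suc m) a b = refl

axis-term : ∀ S m c x b → monoMul 0 c 0ℤ (at-y0 (Q S)) m x (b - 0ℤ) ≡ on-axis (Q S m) (x - c) b
axis-term S m c x b =
  trans (unfold m) (cong (λ t → ind t (Q S m (x - c) 0ℤ)) (==ℤ-injective (λ z → z - 0ℤ - 0ℤ) (λ z → z) inverse b 0ℤ))
  where
  unfold : ∀ m → monoMul 0 c 0ℤ (at-y0 (Q S)) m x (b - 0ℤ) ≡ on-axis (Q S m) (x - c) (b - 0ℤ - 0ℤ)
  unfold zero    = refl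
  unfold (suc m) = refl
  inverse : ∀ z → z - 0ℤ - 0ℤ ≡ z
  inverse = solve-∀

corner-term : ∀ S m a b → at-00 (Q S) m (a - 0ℤ) (b - 0ℤ) ≡ ind (a ==ℤ 0ℤ) (ind (b ==ℤ 0ℤ) (Q S m 0ℤ 0ℤ))
corner-term S m a b =
  trans (ind-∧ ((a - 0ℤ) ==ℤ 0ℤ) ((b - 0ℤ) ==ℤ 0ℤ) (Q S m 0ℤ 0ℤ))
        (cong₂ (λ s t → ind s (ind t (Q S m 0ℤ 0ℤ))) (drop-0 a) (drop-0 b))
  where
  drop-0 : ∀ z → ((z - 0ℤ) ==ℤ 0ℤ) ≡ (z ==ℤ 0ℤ)
  drop-0 z = ==ℤ-injective (λ z → z - 0ℤ) (λ z → z) ℤP.+-identityʳ z 0ℤ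

numerator-boundary : ∀ S m a b → Numerator S (suc m) a b ≡ - orbit (defect S (Q S m)) a b
numerator-boundary S₁ m a b =
  trans (numerator-suc S₁ m a b)
  (trans (cong (λ e → 0ℤ - (+ 2) * (e + 0ℤ) + 0ℤ * at-00 (Q S₁) m (a - 0ℤ) (b - 0ℤ))
               (trans (axis-term S₁ m 0ℤ (x₁ a) b)
                      (cong (λ x → on-axis (Q S₁ m) x b) (ℤP.+-identityʳ (x₁ a)))))
  (trans (shape (on-axis (Q S₁ m) (x₁ a) b) (at-00 (Q S₁) m (a - 0ℤ) (b - 0ℤ)))
         (cong (λ z → - z) (sym (boundary-S₁ (Q-vanishing S₁ m) (Q-symmetric S₁ m) a b)))))
  where
  open Boundary
  shape : ∀ e c → 0ℤ - (+ 2) * (e + 0ℤ) + 0ℤ * c ≡ - (e + e)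
  shape = solve-∀
numerator-boundary S₂ m a b =
  trans (numerator-suc S₂ m a b)
  (trans (cong₂ (λ e c → 0ℤ - (+ 2) * (e + 0ℤ) + 1ℤ * c)
                (axis-term S₂ m -1ℤ (x₁ a) b) (corner-term S₂ m a b))
  (trans (shape (on-axis (Q S₂ m) (x₁ a - -1ℤ) b) (ind (a ==ℤ 0ℤ) (ind (b ==ℤ 0ℤ) (Q S₂ m 0ℤ 0ℤ))))
         (cong (λ z → - z) (sym (boundary-S₂ (Q-vanishing S₂ m) (Q-symmetric S₂ m) a b)))))
  where
  open Boundary
  shape : ∀ e c → 0ℤ - (+ 2) * (e + 0ℤ) + 1ℤ * c ≡ - (e + e - c)
  shape = solve-∀
numerator-boundary S₁∪S₂ m a b =
  trans (numerator-suc S₁∪S₂ m a b)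
  (trans (cong₂ (λ e c → 0ℤ - (+ 2) * e + 1ℤ * c)
                (cong₂ (λ e e′ → e + (e′ + 0ℤ))
                       (trans (axis-term S₁∪S₂ m 0ℤ (x₁ a) b)
                              (cong (λ x → on-axis f x b) (ℤP.+-identityʳ (x₁ a))))
                       (axis-term S₁∪S₂ m -1ℤ (x₁ a) b))
                (corner-term S₁∪S₂ m a b))
  (trans (shape (on-axis f (x₁ a) b) (on-axis f (x₁ a - -1ℤ) b)
                (ind (a ==ℤ 0ℤ) (ind (b ==ℤ 0ℤ) (f 0ℤ 0ℤ))))
         (cong (λ z → - z) (sym (trans (boundary-S₁∪S₂ V f-sym a b)
                                   (cong₂ _+_ (boundary-S₁ V f-sym a b) (boundary-S₂ V f-sym a b)))))))
  where
  open Boundary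
  f : Fn
  f = Q S₁∪S₂ m
  V : Vanishing f
  V = Q-vanishing S₁∪S₂ m
  f-sym : ∀ i j → f i j ≡ f j i
  f-sym = Q-symmetric S₁∪S₂ m
  shape : ∀ e e′ c → 0ℤ - (+ 2) * (e + (e′ + 0ℤ)) + 1ℤ * c ≡ - (e + e + (e′ + e′ - c))
  shape = solve-∀

LHS-suc : ∀ S m a b →
  LHS S (suc m) a b ≡ Numerator S (suc m) a b + Σ[ u , v ∈ steps S ] LHS S m (a - u) (b - v)
LHS-suc S m a b = begin
  LHS S (suc m) a b
    ≡⟨ LHS-orbit S (suc m) a b ⟩
  orbit (Q S (suc m)) a b
    ≡⟨ orbit-cong (Q-suc-defect S m) a b ⟩
  orbit (λ i j → convolution i j - defect S f i j) a b
    ≡⟨ orbit-- convolution (defect S f) a b ⟩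
  orbit convolution a b - orbit (defect S f) a b
    ≡⟨ cong (λ z → z - orbit (defect S f) a b) (sym (orbit-convolution S f a b)) ⟩
  Σ[ u , v ∈ steps S ] orbit f (a - u) (b - v) - orbit (defect S f) a b
    ≡⟨ swap-sides (Σ[ u , v ∈ steps S ] orbit f (a - u) (b - v)) (orbit (defect S f) a b) ⟩
  - orbit (defect S f) a b + Σ[ u , v ∈ steps S ] orbit f (a - u) (b - v)
    ≡⟨ cong₂ _+_ (sym (numerator-boundary S m a b))
                 (Σ-cong (steps S) (λ u v → sym (LHS-orbit S m (a - u) (b - v)))) ⟩
  Numerator S (suc m) a b + Σ[ u , v ∈ steps S ] LHS S m (a - u) (b - v) ∎
  where
  open ≡-Reasoning
  f : Fn
  f = Q S m
  convolution : Fn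
  convolution i j = Σ[ u , v ∈ steps S ] f (i - u) (j - v)
  swap-sides : ∀ p q → p - q ≡ - q + p
  swap-sides = solve-∀

-- At t^0 both sides are  x y - x̄ + ȳ: the only walk of length 0 ends at the
-- origin, which is the first orbit point iff (a, b) = (1, 1), the second iff
-- (a, b) = (-1, 0), and the third iff (a, b) = (0, -1).
module _ where
  private
    first-at-origin : ∀ a b → (0ℤ ==ℤ x₁ a) ∧ (0ℤ ==ℤ x₁ b) ≡ (a ==ℤ 1ℤ) ∧ (b ==ℤ 1ℤ)
    first-at-origin a b = cong₂ _∧_ (at-1 a) (at-1 b)
      where
      inverse : ∀ z → z - 1ℤ + 1ℤ ≡ z
      inverse = solve-∀
      at-1 : ∀ a → (0ℤ ==ℤ x₁ a) ≡ (a ==ℤ 1ℤ)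
      at-1 a = trans (==ℤ-sym 0ℤ (x₁ a)) (==ℤ-injective x₁ (λ z → z + 1ℤ) inverse a 1ℤ)

    second-at-origin : ∀ a b → (0ℤ ==ℤ x₂ a) ∧ (0ℤ ==ℤ y₂ a b) ≡ (a ==ℤ -1ℤ) ∧ (b ==ℤ 0ℤ)
    second-at-origin a b =
      trans (cong (λ t → t ∧ (0ℤ ==ℤ y₂ a b)) x-test)
      (trans (∧-subst a -1ℤ (λ z → 0ℤ ==ℤ y₂ z b)) (cong (λ t → (a ==ℤ -1ℤ) ∧ t) y-test))
      where
      x-inverse : ∀ z → - (- (z - -1ℤ)) - 1ℤ ≡ z
      x-inverse = solve-∀
      x-test : (0ℤ ==ℤ x₂ a) ≡ (a ==ℤ -1ℤ)
      x-test = trans (==ℤ-sym 0ℤ (x₂ a)) (==ℤ-injective x₂ (λ z → - z - 1ℤ) x-inverse a -1ℤ)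
      y-inverse : ∀ z → z - 0ℤ - 0ℤ ≡ z
      y-inverse = solve-∀
      y-test : (0ℤ ==ℤ y₂ -1ℤ b) ≡ (b ==ℤ 0ℤ)
      y-test = trans (==ℤ-sym 0ℤ (y₂ -1ℤ b))
                     (==ℤ-injective (λ z → z - 0ℤ - 0ℤ) (λ z → z) y-inverse b 0ℤ)

    numerator-zero : ∀ S a b → Numerator S 0 a b
      ≡ ind ((a ==ℤ 1ℤ) ∧ (b ==ℤ 1ℤ)) 1ℤ - ind ((a ==ℤ -1ℤ) ∧ (b ==ℤ 0ℤ)) 1ℤ
        + ind ((a ==ℤ 0ℤ) ∧ (b ==ℤ -1ℤ)) 1ℤ
    numerator-zero S a b =
      trans (cong (λ z → monomials - 0ℤ + z) (ℤP.*-zeroʳ (ε S))) (drop-zeros monomials)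
      where
      monomials : ℤ
      monomials = ind ((a ==ℤ 1ℤ) ∧ (b ==ℤ 1ℤ)) 1ℤ - ind ((a ==ℤ -1ℤ) ∧ (b ==ℤ 0ℤ)) 1ℤ
                  + ind ((a ==ℤ 0ℤ) ∧ (b ==ℤ -1ℤ)) 1ℤ
      drop-zeros : ∀ z → z - 0ℤ + 0ℤ ≡ z
      drop-zeros = solve-∀

  LHS-zero : ∀ S a b → LHS S 0 a b ≡ Numerator S 0 a b
  LHS-zero S a b =
    trans (LHS-orbit S 0 a b)
    (trans (orbit-cong (Q-zero S) a b)
    (trans (cong₂ _+_ (cong₂ _-_ (cong (λ t → ind t 1ℤ) (first-at-origin a b))
                                 (cong (λ t → ind t 1ℤ) (second-at-origin a b)))
                      (cong (λ t → ind t 1ℤ) (trans (second-at-origin b a) (∧-comm (b ==ℤ -1ℤ) (a ==ℤ 0ℤ)))))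
           (sym (numerator-zero S a b))))

divK-unique : ∀ S (N F : Ser) → (∀ a b → F 0 a b ≡ N 0 a b) →
  (∀ n a b → F (suc n) a b ≡ N (suc n) a b + Σ[ u , v ∈ steps S ] F n (a - u) (b - v)) →
  ∀ n a b → F n a b ≡ divK S N n a b
divK-unique S N F F-zero F-suc zero    a b = F-zero a b
divK-unique S N F F-zero F-suc (suc n) a b =
  trans (F-suc n a b)
  (trans (cong (λ z → N (suc n) a b + z)
               (Σ-cong (steps S) (λ u v → divK-unique S N F F-zero F-suc n (a - u) (b - v))))
         (sym (divK-suc S)))
  where
  divK-suc : ∀ S → divK S N (suc n) a b
                     ≡ N (suc n) a b + Σ[ u , v ∈ steps S ] divK S N n (a - u) (b - v)
  divK-suc S₁    = refl
  divK-suc S₂    = refl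
  divK-suc S₁∪S₂ = refl

proposition6 : (S : StepSet) (n : ℕ) (a b : ℤ) → LHS S n a b ≡ RHS S n a b
proposition6 S = divK-unique S (Numerator S) (LHS S) (LHS-zero S) (LHS-suc S)
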